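{- Let $X$ be a robust $X$-set parameter and let $G$ and $G'$ be graphs such that $\mathfrak{X}(G)\cong\mathfrak{X}(G')$. Suppose further that $X(K_1)=0$ or that $G$ and $G'$ have no isolated vertices. Then $|V(G)|=|V(G')|$, $X(G)=X(G')$, and $\overline{X}(G)=\overline{X}(G')$.
   Context: All graphs are finite, simple, undirected, with nonempty vertex set. A vertex set property assigns to each graph $G$ a family of subsets of $V(G)$ (the $X$-sets of $G$), invariant under graph isomorphism; it is cohesive if every graph has at least one $X$-set. A robust $X$-set parameter is a cohesive vertex set property satisfying: (Superset) if $S$ is an $X$-set of $G$ and $S\subseteq S'\subseteq V(G)$ then $S'$ is an $X$-set; ($(n-1)$-set) if $G$ is connected of order $n\ge 2$, every set of $n-1$ vertices of $G$ is an $X$-set; (Component consistency) if $G_1,\dots,G_k$ are the connected components of $G$, then $S$ is an $X$-set of $G$ iff $S\cap V(G_i)$ is an $X$-set of $G_i$ for every $i$. $X(G)$ is the minimum cardinality of an $X$-set of $G$, $X(K_1)$ its value on the one-vertex graph, and $\overline{X}(G)$ the maximum cardinality of a minimal (under inclusion) $X$-set. The $X$-TAR graph $\mathfrak{X}(G)$ has as vertices the $X$-sets of $G$, with $S_1,S_2$ adjacent iff $|S_1\ominus S_2|=1$. -}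

module Defs where

open import Data.Bool using (Bool; true; false; _xor_)
open import Data.Nat using (ℕ; zero; suc; _≤_)
open import Data.Fin using (Fin)
open import Data.Fin.Subset using (Subset; ∣_∣; _⊆_; ⊥)
open import Data.Vec using (tabulate; lookup; zipWith)
open import Data.Product using (Σ; ∃; _×_; _,_)
open import Function.Bundles using (_↔_; Inverse)
open import Function.Definitions using (Injective)
open import Relation.Binary.PropositionalEquality using (_≡_; refl)

-- A finite simple graph with nonempty vertex set Fin (suc m)
-- (so the order is suc m).
record Graph : Set where
  field
    m     : ℕ
    adj   : Fin (suc m) → Fin (suc m) → Bool
    sym   : ∀ u v → adj u v ≡ adj v u
    irref : ∀ v → adj v v ≡ false

  N : ℕ
  N = suc m

open Graph public

V : Graph → Set
V G = Fin (N G)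

K₁ : Graph
K₁ = record { m = 0 ; adj = λ _ _ → false ; sym = λ _ _ → refl ; irref = λ _ → refl }

data Reach (G : Graph) : V G → V G → Set where
  here : ∀ {u} → Reach G u u
  step : ∀ {u w v} → adj G u w ≡ true → Reach G w v → Reach G u v

Connected : Graph → Set
Connected G = ∀ u v → Reach G u v

NoIsolated : Graph → Set
NoIsolated G = ∀ (v : V G) → ∃ λ u → adj G v u ≡ true

induced : (G : Graph) {k : ℕ} → (Fin (suc k) → V G) → Graph
induced G {k} e = record
  { m = k
  ; adj = λ i j → adj G (e i) (e j)
  ; sym = λ i j → sym G (e i) (e j)
  ; irref = λ i → irref G (e i) }

preimage : ∀ {a b} → (Fin a → Fin b) → Subset b → Subset a
preimage f S = tabulate (λ i → lookup S (f i))

record GraphIso (G H : Graph) : Set where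
  field
    bij      : V G ↔ V H
    preserve : ∀ u v → adj H (Inverse.to bij u) (Inverse.to bij v) ≡ adj G u v

-- A vertex set property: for each graph, the (decidable, as it is a family
-- of subsets of a finite set) family of its X-sets.
VertexSetProperty : Set
VertexSetProperty = (G : Graph) → Subset (N G) → Bool

IsXSet : VertexSetProperty → (G : Graph) → Subset (N G) → Set
IsXSet X G S = X G S ≡ true

record RobustParameter (X : VertexSetProperty) : Set where
  field
    iso-invariant : ∀ G H (φ : GraphIso G H) (T : Subset (N H)) →
                    X H T ≡ X G (preimage (Inverse.to (GraphIso.bij φ)) T)
    cohesive      : ∀ G → ∃ λ S → IsXSet X G S
    superset      : ∀ G (S S′ : Subset (N G)) → IsXSet X G S → S ⊆ S′ → IsXSet X G S′
    -- (n-1)-set property (order n = suc m ≥ 2, i.e. m ≥ 1)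
    n-1-set       : ∀ G → Connected G → 1 ≤ m G → (S : Subset (N G)) →
                    ∣ S ∣ ≡ m G → IsXSet X G S
    -- component consistency: the components of G are the reachability
    -- classes of vertices v, each presented as the induced subgraph on an
    -- injective enumeration e of the class
    component     : ∀ G (S : Subset (N G)) →
                    (IsXSet X G S →
                      ∀ v k (e : Fin (suc k) → V G) → Injective _≡_ _≡_ e →
                      (∀ u → (Reach G v u → ∃ λ i → e i ≡ u) × (∃ (λ i → e i ≡ u) → Reach G v u)) →
                      IsXSet X (induced G e) (preimage e S))
                    ×
                    ((∀ v k (e : Fin (suc k) → V G) → Injective _≡_ _≡_ e →
                      (∀ u → (Reach G v u → ∃ λ i → e i ≡ u) × (∃ (λ i → e i ≡ u) → Reach G v u)) →
                      IsXSet X (induced G e) (preimage e S)) →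
                     IsXSet X G S)

IsXNumber : VertexSetProperty → Graph → ℕ → Set
IsXNumber X G k = (∃ λ S → IsXSet X G S × ∣ S ∣ ≡ k)
                × (∀ S → IsXSet X G S → k ≤ ∣ S ∣)

MinimalXSet : VertexSetProperty → (G : Graph) → Subset (N G) → Set
MinimalXSet X G S = IsXSet X G S × (∀ T → T ⊆ S → IsXSet X G T → T ≡ S)

IsUpperXNumber : VertexSetProperty → Graph → ℕ → Set
IsUpperXNumber X G k = (∃ λ S → MinimalXSet X G S × ∣ S ∣ ≡ k)
                     × (∀ S → MinimalXSet X G S → ∣ S ∣ ≤ k)

TARVertex : VertexSetProperty → Graph → Set
TARVertex X G = Σ (Subset (N G)) (IsXSet X G)

symDiff : ∀ {n} → Subset n → Subset n → Subset n
symDiff = zipWith _xor_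

TARAdj : (X : VertexSetProperty) (G : Graph) → TARVertex X G → TARVertex X G → Set
TARAdj X G (S₁ , _) (S₂ , _) = ∣ symDiff S₁ S₂ ∣ ≡ 1

record TARIso (X : VertexSetProperty) (G H : Graph) : Set where
  field
    bij      : TARVertex X G ↔ TARVertex X H
    preserve : ∀ a b → (TARAdj X G a b → TARAdj X H (Inverse.to bij a) (Inverse.to bij b))
                     × (TARAdj X H (Inverse.to bij a) (Inverse.to bij b) → TARAdj X G a b)

-- Call the X-sets of a graph its family, and the X-TAR graph the flip graph
-- of that family: an edge toggles one vertex. Under either hypothesis every
-- set missing at most one vertex is an X-set (by component consistency: a
-- component avoiding the vertex contributes its full vertex set, one of order
-- at least 2 uses the (n-1)-set property, and a one-vertex component is either
-- excluded or has the empty set as an X-set), so both families are up-closed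
-- and contain V and every V - a.
--
-- For such families a flip-graph isomorphism φ commutes with toggles,
-- φ (S ⊕ a) = φ S ⊕ π a, where π a labels the edge from V to V - a: in a
-- square S, S ⊕ a, S ⊕ b, S ⊕ a ⊕ b of the family parallel edges get the same
-- label, and such squares lead from any edge up to an edge at V. Hence
-- φ S = φ V ⊕ π[V - S]. Applying this to φ⁻¹ shows that π is a bijection, and
-- up-closure of both families then gives: S is an X-set of G iff π[S] is an
-- X-set of G′. Relabelling vertices along π preserves cardinality and
-- inclusion, so the order, X and upper X agree.

module Submission where

open import Defs hiding (sym)

open import Axiom.UniquenessOfIdentityProofs using (module Decidable⇒UIP)
open import Data.Bool using (Bool; true; false; not; _xor_; _∨_; if_then_else_)
open import Data.Bool.Properties
  using (not-involutive; not-¬; ¬-not; xor-same; xor-assoc; xor-comm; xor-identityʳ; not-distribˡ-xor)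
  renaming (_≟_ to _≟ᵇ_)
open import Data.Empty using (⊥-elim)
open import Data.Fin using (Fin; zero; suc)
open import Data.Fin.Permutation as Perm using (Permutation; _⟨$⟩ʳ_; _⟨$⟩ˡ_; permutation; ↔⇒≡)
open import Data.Fin.Properties using (_≟_; any?)
open import Data.Fin.Subset using (Subset; ∣_∣; _⊆_; _∈_; _∉_; ⊤; ⊥; ⁅_⁆; ∁; _∪_)
open import Data.Fin.Subset.Properties using (_∈?_; ∈⊤; ⊆⊤; ⊆-antisym; p⊆p∪q; ∣⊤∣≡n; ∣⁅x⁆∣≡1)
open import Data.Nat using (ℕ; zero; suc; _≤_; _<_; z≤n; s≤s)
open import Data.Nat.Induction using (<-wellFounded)
open import Data.Nat.Properties
  using (n<1+n; suc-injective; ≤-trans; ≤-reflexive; ≤-antisym; +-0-commutativeMonoid)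
open import Algebra.Properties.CommutativeMonoid.Sum +-0-commutativeMonoid using (sum; sum-cong-≗; sum-permute)
open import Data.Product using (Σ; ∃; _×_; _,_; proj₁; proj₂)
open import Data.Sum using (_⊎_; inj₁; inj₂; map₂)
open import Data.Vec using ([]; _∷_; lookup; tabulate; updateAt; here; there)
open import Data.Vec.Properties
  using ( lookup∘tabulate; lookup-zipWith; lookup-replicate; []=⇒lookup; lookup⇒[]=
        ; lookup∘updateAt; lookup∘updateAt′; updateAt-updateAt-local; updateAt-id
        ; updateAt-commutes; updateAt-minimal)
open import Data.Vec.Relation.Binary.Pointwise.Extensional using (ext; Pointwise-≡⇒≡)
open import Function using (_∘_)
open import Function.Bundles using (_↔_; Inverse; Injection)
open import Function.Construct.Identity using (↔-id)
open import Function.Construct.Symmetry using (↔-sym)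
open import Function.Definitions using (Injective)
open import Function.Properties.Inverse using (Inverse⇒Injection)
open import Induction.WellFounded using (Acc; acc)
open import Relation.Binary.PropositionalEquality
  using (_≡_; _≢_; refl; sym; trans; cong; cong₂; subst; module ≡-Reasoning)
open import Relation.Nullary using (¬_; yes; no; ¬?; contradiction)
open import Relation.Nullary.Decidable using (_×-dec_; decidable-stable)

open Decidable⇒UIP _≟ᵇ_ using (≡-irrelevant)

private variable
  n n′ : ℕ

-- Toggling one element of a subset

toggle : Subset n → Fin n → Subset n
toggle S c = updateAt S c not

lookup-toggle-≡ : ∀ (S : Subset n) c → lookup (toggle S c) c ≡ not (lookup S c)
lookup-toggle-≡ S c = lookup∘updateAt c S

lookup-toggle-≢ : ∀ (S : Subset n) {c i} → i ≢ c → lookup (toggle S c) i ≡ lookup S i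
lookup-toggle-≢ S {c} {i} i≢c = lookup∘updateAt′ i c i≢c S

toggle-involutive : ∀ (S : Subset n) c → toggle (toggle S c) c ≡ S
toggle-involutive S c = trans (updateAt-updateAt-local c S (not-involutive _)) (updateAt-id c S)

toggle-comm : ∀ (S : Subset n) {a b} → a ≢ b → toggle (toggle S a) b ≡ toggle (toggle S b) a
toggle-comm S {a} {b} a≢b = updateAt-commutes b a (a≢b ∘ sym) S

toggle-injective : ∀ (S : Subset n) {a b} → toggle S a ≡ toggle S b → a ≡ b
toggle-injective S {a} {b} eq with a ≟ b
... | yes a≡b = a≡b
... | no a≢b = contradiction S[a]≡not-S[a] (not-¬ refl)
  where
  open ≡-Reasoning
  S[a]≡not-S[a] : lookup S a ≡ not (lookup S a)
  S[a]≡not-S[a] = begin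
    lookup S a            ≡⟨ lookup-toggle-≢ S a≢b ⟨
    lookup (toggle S b) a ≡⟨ cong (λ T → lookup T a) eq ⟨
    lookup (toggle S a) a ≡⟨ lookup-toggle-≡ S a ⟩
    not (lookup S a)      ∎

toggle-square : ∀ (S : Subset n) {c d e p} → e ≢ c → e ≢ d →
                toggle (toggle S e) d ≡ toggle (toggle S c) p → e ≡ p
toggle-square S {c} {d} {e} {p} e≢c e≢d eq with e ≟ p
... | yes e≡p = e≡p
... | no e≢p = contradiction S[e]≡not-S[e] (not-¬ refl)
  where
  open ≡-Reasoning
  S[e]≡not-S[e] : lookup S e ≡ not (lookup S e)
  S[e]≡not-S[e] = begin
    lookup S e                         ≡⟨ lookup-toggle-≢ S e≢c ⟨
    lookup (toggle S c) e              ≡⟨ lookup-toggle-≢ (toggle S c) e≢p ⟨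
    lookup (toggle (toggle S c) p) e   ≡⟨ cong (λ T → lookup T e) eq ⟨
    lookup (toggle (toggle S e) d) e   ≡⟨ lookup-toggle-≢ (toggle S e) e≢d ⟩
    lookup (toggle S e) e              ≡⟨ lookup-toggle-≡ S e ⟩
    not (lookup S e)                   ∎

⊆-toggle : ∀ {S : Subset n} {b} → b ∉ S → S ⊆ toggle S b
⊆-toggle {S = S} {b} b∉S {x} x∈S = updateAt-minimal x b S (λ x≡b → b∉S (subst (_∈ S) x≡b x∈S)) x∈S

∣∁toggle∣<∣∁∣ : ∀ {S : Subset n} {b} → b ∉ S → ∣ ∁ (toggle S b) ∣ < ∣ ∁ S ∣
∣∁toggle∣<∣∁∣ {S = true  ∷ S} {zero}  b∉S = contradiction here b∉S
∣∁toggle∣<∣∁∣ {S = false ∷ S} {zero}  _   = n<1+n _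
∣∁toggle∣<∣∁∣ {S = true  ∷ S} {suc b} b∉S = ∣∁toggle∣<∣∁∣ (b∉S ∘ there)
∣∁toggle∣<∣∁∣ {S = false ∷ S} {suc b} b∉S = s≤s (∣∁toggle∣<∣∁∣ (b∉S ∘ there))

Adjacent : Subset n → Subset n → Set
Adjacent S T = ∣ symDiff S T ∣ ≡ 1

symDiff-cancelˡ : ∀ (S T : Subset n) → symDiff S (symDiff S T) ≡ T
symDiff-cancelˡ []      []      = refl
symDiff-cancelˡ (x ∷ S) (y ∷ T) =
  cong₂ _∷_ (trans (sym (xor-assoc x x y)) (cong (_xor y) (xor-same x))) (symDiff-cancelˡ S T)

symDiff-⁅⁆ : ∀ (S : Subset n) c → symDiff S ⁅ c ⁆ ≡ toggle S c
symDiff-⁅⁆ (x ∷ S) zero    = cong₂ _∷_ (xor-comm x true) (symDiff-⊥ S)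
  where
  symDiff-⊥ : ∀ {n} (S : Subset n) → symDiff S ⊥ ≡ S
  symDiff-⊥ []      = refl
  symDiff-⊥ (x ∷ S) = cong₂ _∷_ (xor-identityʳ x) (symDiff-⊥ S)
symDiff-⁅⁆ (x ∷ S) (suc c) = cong₂ _∷_ (xor-identityʳ x) (symDiff-⁅⁆ S c)

∣p∣≡0⇒p≡⊥ : ∀ {p : Subset n} → ∣ p ∣ ≡ 0 → p ≡ ⊥
∣p∣≡0⇒p≡⊥ {p = []}        _ = refl
∣p∣≡0⇒p≡⊥ {p = false ∷ p} h = cong (false ∷_) (∣p∣≡0⇒p≡⊥ h)

∣p∣≡1⇒p≡⁅x⁆ : ∀ {p : Subset n} → ∣ p ∣ ≡ 1 → ∃ λ x → p ≡ ⁅ x ⁆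
∣p∣≡1⇒p≡⁅x⁆ {p = true  ∷ p} h = zero , cong (true ∷_) (∣p∣≡0⇒p≡⊥ (suc-injective h))
∣p∣≡1⇒p≡⁅x⁆ {p = false ∷ p} h with ∣p∣≡1⇒p≡⁅x⁆ h
... | x , p≡⁅x⁆ = suc x , cong (false ∷_) p≡⁅x⁆

adjacent-toggle : ∀ (S : Subset n) c → Adjacent S (toggle S c)
adjacent-toggle S c = begin
  ∣ symDiff S (toggle S c) ∣            ≡⟨ cong (∣_∣ ∘ symDiff S) (symDiff-⁅⁆ S c) ⟨
  ∣ symDiff S (symDiff S ⁅ c ⁆) ∣       ≡⟨ cong ∣_∣ (symDiff-cancelˡ S ⁅ c ⁆) ⟩
  ∣ ⁅ c ⁆ ∣                             ≡⟨ ∣⁅x⁆∣≡1 c ⟩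
  1                                     ∎
  where open ≡-Reasoning

adjacent⇒toggle : ∀ (S T : Subset n) → Adjacent S T → ∃ λ c → T ≡ toggle S c
adjacent⇒toggle S T adj with ∣p∣≡1⇒p≡⁅x⁆ adj
... | c , S⊕T≡⁅c⁆ = c , (begin
  T                         ≡⟨ symDiff-cancelˡ S T ⟨
  symDiff S (symDiff S T)   ≡⟨ cong (symDiff S) S⊕T≡⁅c⁆ ⟩
  symDiff S ⁅ c ⁆           ≡⟨ symDiff-⁅⁆ S c ⟩
  toggle S c                ∎)
  where open ≡-Reasoning

∈-toggle : ∀ {S : Subset n} {a} → a ∉ S → a ∈ toggle S a
∈-toggle {S = S} {a} a∉S = lookup⇒[]= a _ (trans (lookup-toggle-≡ S a) (cong not (¬-not (a∉S ∘ lookup⇒[]= a S))))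

∉-toggle : ∀ {S : Subset n} {a b} → b ≢ a → b ∉ S → b ∉ toggle S a
∉-toggle {S = S} {a} {b} b≢a b∉S b∈S⊕a =
  b∉S (subst (b ∈_) (toggle-involutive S a) (updateAt-minimal b a (toggle S a) b≢a b∈S⊕a))

∈-all-except : ∀ {T : Subset n} {a} → a ∈ T → (∀ b → b ≢ a → b ∈ T) → T ≡ ⊤
∈-all-except {T = T} {a} a∈T ∈T-except = ⊆-antisym ⊆⊤ (λ {b} _ → ∈T b)
  where
  ∈T : ∀ b → b ∈ T
  ∈T b with b ≟ a
  ... | yes refl = a∈T
  ... | no b≢a   = ∈T-except b b≢a

near-⊤ : ∀ {S : Subset n} {a} → (∀ b → b ≢ a → b ∈ S) → S ≡ ⊤ ⊎ toggle S a ≡ ⊤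
near-⊤ {S = S} {a} ∈S-except with a ∈? S
... | yes a∈S = inj₁ (∈-all-except a∈S ∈S-except)
... | no  a∉S = inj₂ (∈-all-except (∈-toggle a∉S) (λ b b≢a → ⊆-toggle a∉S (∈S-except b b≢a)))

⊤-or-∉ : ∀ (S : Subset n) → S ≡ ⊤ ⊎ ∃ (_∉ S)
⊤-or-∉ S with any? (λ b → ¬? (b ∈? S))
... | yes found = inj₂ found
... | no  none  = inj₁ (⊆-antisym ⊆⊤ (λ {b} _ → decidable-stable (b ∈? S) (λ b∉S → none (b , b∉S))))

∣toggle⊤∣ : ∀ {k} (i : Fin (suc k)) → ∣ toggle ⊤ i ∣ ≡ k
∣toggle⊤∣ {k}     zero    = ∣⊤∣≡n k
∣toggle⊤∣ {suc k} (suc i) = cong suc (∣toggle⊤∣ i)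

-- Preimages along maps of indices

lookup-preimage : ∀ (f : Fin n′ → Fin n) S i → lookup (preimage f S) i ≡ lookup S (f i)
lookup-preimage f S i = lookup∘tabulate _ i

preimage-inverse : ∀ (f : Fin n′ → Fin n) (g : Fin n → Fin n′) → (∀ i → g (f i) ≡ i) →
                   ∀ S → preimage f (preimage g S) ≡ S
preimage-inverse f g g∘f S = Pointwise-≡⇒≡ (ext λ i → begin
  lookup (preimage f (preimage g S)) i   ≡⟨ lookup-preimage f (preimage g S) i ⟩
  lookup (preimage g S) (f i)            ≡⟨ lookup-preimage g S (f i) ⟩
  lookup S (g (f i))                     ≡⟨ cong (lookup S) (g∘f i) ⟩
  lookup S i                             ∎)
  where open ≡-Reasoning

preimage-mono : ∀ (f : Fin n′ → Fin n) {S T} → S ⊆ T → preimage f S ⊆ preimage f T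
preimage-mono f {S} {T} S⊆T {i} i∈f*S = lookup⇒[]= i _ (trans (lookup-preimage f T i)
  ([]=⇒lookup (S⊆T (lookup⇒[]= (f i) S (trans (sym (lookup-preimage f S i)) ([]=⇒lookup i∈f*S))))))

∣p∣≡sum : ∀ (S : Subset n) → ∣ S ∣ ≡ sum (λ i → if lookup S i then 1 else 0)
∣p∣≡sum []          = refl
∣p∣≡sum (true  ∷ S) = cong suc (∣p∣≡sum S)
∣p∣≡sum (false ∷ S) = ∣p∣≡sum S

∣preimage∣ : ∀ (σ : Permutation n′ n) S → ∣ preimage (σ ⟨$⟩ʳ_) S ∣ ≡ ∣ S ∣
∣preimage∣ σ S = begin
  ∣ preimage (σ ⟨$⟩ʳ_) S ∣                           ≡⟨ ∣p∣≡sum (preimage (σ ⟨$⟩ʳ_) S) ⟩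
  sum (indicator ∘ lookup (preimage (σ ⟨$⟩ʳ_) S))    ≡⟨ sum-cong-≗ (cong indicator ∘ lookup-preimage (σ ⟨$⟩ʳ_) S) ⟩
  sum (indicator ∘ lookup S ∘ (σ ⟨$⟩ʳ_))             ≡⟨ sum-permute (indicator ∘ lookup S) σ ⟨
  sum (indicator ∘ lookup S)                         ≡⟨ ∣p∣≡sum S ⟨
  ∣ S ∣                                              ∎
  where
  open ≡-Reasoning
  indicator : Bool → ℕ
  indicator b = if b then 1 else 0

lookup-⊤ : ∀ (i : Fin n) → lookup ⊤ i ≡ true
lookup-⊤ i = lookup-replicate i true

preimage-⊤ : ∀ (f : Fin n′ → Fin n) → preimage f ⊤ ≡ ⊤
preimage-⊤ f = Pointwise-≡⇒≡ (ext λ i → trans (lookup-preimage f ⊤ i) (trans (lookup-⊤ (f i)) (sym (lookup-⊤ i))))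

preimage-toggle : ∀ {f : Fin n′ → Fin n} → Injective _≡_ _≡_ f →
                  ∀ S i → preimage f (toggle S (f i)) ≡ toggle (preimage f S) i
preimage-toggle {f = f} f-inj S i = Pointwise-≡⇒≡ (ext pointwise)
  where
  open ≡-Reasoning
  pointwise : ∀ j → lookup (preimage f (toggle S (f i))) j ≡ lookup (toggle (preimage f S) i) j
  pointwise j with j ≟ i
  ... | yes refl = begin
    lookup (preimage f (toggle S (f j))) j   ≡⟨ lookup-preimage f (toggle S (f j)) j ⟩
    lookup (toggle S (f j)) (f j)            ≡⟨ lookup-toggle-≡ S (f j) ⟩
    not (lookup S (f j))                     ≡⟨ cong not (lookup-preimage f S j) ⟨
    not (lookup (preimage f S) j)            ≡⟨ lookup-toggle-≡ (preimage f S) j ⟨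
    lookup (toggle (preimage f S) j) j       ∎
  ... | no j≢i = begin
    lookup (preimage f (toggle S (f i))) j   ≡⟨ lookup-preimage f (toggle S (f i)) j ⟩
    lookup (toggle S (f i)) (f j)            ≡⟨ lookup-toggle-≢ S (j≢i ∘ f-inj) ⟩
    lookup S (f j)                           ≡⟨ lookup-preimage f S j ⟨
    lookup (preimage f S) j                  ≡⟨ lookup-toggle-≢ (preimage f S) j≢i ⟨
    lookup (toggle (preimage f S) i) j       ∎

preimage-toggle-∉ : ∀ {f : Fin n′ → Fin n} {v} → (∀ i → f i ≢ v) →
                    ∀ S → preimage f (toggle S v) ≡ preimage f S
preimage-toggle-∉ {f = f} {v} v∉f S = Pointwise-≡⇒≡ (ext λ j → begin
  lookup (preimage f (toggle S v)) j   ≡⟨ lookup-preimage f (toggle S v) j ⟩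
  lookup (toggle S v) (f j)            ≡⟨ lookup-toggle-≢ S (v∉f j) ⟩
  lookup S (f j)                       ≡⟨ lookup-preimage f S j ⟨
  lookup (preimage f S) j              ∎)
  where open ≡-Reasoning

-- Flip graphs of robust families

Family : ℕ → Set
Family n = Subset n → Bool

UpClosed : Family n → Set
UpClosed P = ∀ {S T} → S ⊆ T → P S ≡ true → P T ≡ true

record RobustFamily (P : Family n) : Set where
  field
    upClosed : UpClosed P
    ⊤∈       : P ⊤ ≡ true
    coatom∈  : ∀ a → P (toggle ⊤ a) ≡ true

Members : Family n → Set
Members {n} P = Σ (Subset n) (λ S → P S ≡ true)

members-≡ : ∀ {P : Family n} {a b : Members P} → proj₁ a ≡ proj₁ b → a ≡ b
members-≡ {a = S , p} {b = .S , q} refl = cong (S ,_) (≡-irrelevant p q)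

record FlipGraphIso (P : Family n) (P′ : Family n′) : Set where
  field
    bij       : Members P ↔ Members P′
    adjacent⁺ : ∀ a b → Adjacent (proj₁ a) (proj₁ b) →
                Adjacent (proj₁ (Inverse.to bij a)) (proj₁ (Inverse.to bij b))
    adjacent⁻ : ∀ a b → Adjacent (proj₁ (Inverse.to bij a)) (proj₁ (Inverse.to bij b)) →
                Adjacent (proj₁ a) (proj₁ b)

flipGraphIso-sym : ∀ {P : Family n} {P′ : Family n′} → FlipGraphIso P P′ → FlipGraphIso P′ P
flipGraphIso-sym {P′ = P′} Φ = record
  { bij       = ↔-sym bij
  ; adjacent⁺ = λ a b → adjacent⁻ (from a) (from b)
                        ∘ adjacent-cong (sym (strictlyInverseˡ a)) (sym (strictlyInverseˡ b))
  ; adjacent⁻ = λ a b → adjacent-cong (strictlyInverseˡ a) (strictlyInverseˡ b) ∘ adjacent⁺ (from a) (from b)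
  }
  where
  open FlipGraphIso Φ
  open Inverse bij using (from; strictlyInverseˡ)
  adjacent-cong : ∀ {a a′ b b′ : Members P′} → a ≡ a′ → b ≡ b′ →
                  Adjacent (proj₁ a) (proj₁ b) → Adjacent (proj₁ a′) (proj₁ b′)
  adjacent-cong refl refl adj = adj

module EdgeLabelling {P : Family n} {P′ : Family n′}
  (RP : RobustFamily P) (upClosed′ : UpClosed P′) (Φ : FlipGraphIso P P′) where

  open RobustFamily RP
  open FlipGraphIso Φ
  open Inverse bij using (to)

  φ : (S : Subset n) → P S ≡ true → Subset n′
  φ S p = proj₁ (to (S , p))

  φ∈ : ∀ S p → P′ (φ S p) ≡ true
  φ∈ S p = proj₂ (to (S , p))

  φ-cong : ∀ {S T} p q → S ≡ T → φ S p ≡ φ T q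
  φ-cong p q refl = cong (φ _) (≡-irrelevant p q)

  φ-injective : ∀ {S T} p q → φ S p ≡ φ T q → S ≡ T
  φ-injective p q eq =
    cong proj₁ (Injection.injective (Inverse⇒Injection bij) (members-≡ eq))

  toggle-label : ∀ S p a q → ∃ λ e → φ (toggle S a) q ≡ toggle (φ S p) e
  toggle-label S p a q = adjacent⇒toggle _ _ (adjacent⁺ (S , p) (toggle S a , q) (adjacent-toggle S a))

  z : Subset n′
  z = φ ⊤ ⊤∈

  π : Fin n → Fin n′
  π a = proj₁ (toggle-label ⊤ ⊤∈ a (coatom∈ a))

  φ-coatom : ∀ a → φ (toggle ⊤ a) (coatom∈ a) ≡ toggle z (π a)
  φ-coatom a = proj₂ (toggle-label ⊤ ⊤∈ a (coatom∈ a))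

  distinct-labels : ∀ {S a b e c} p q r → φ (toggle S a) q ≡ toggle (φ S p) e →
                    φ (toggle S b) r ≡ toggle (φ S p) c → e ≡ c → a ≡ b
  distinct-labels {S} p q r Ea Eb refl = toggle-injective S (φ-injective q r (trans Ea (sym Eb)))

  no-backtracking : ∀ {S a b e d} p q r → φ (toggle S a) q ≡ toggle (φ S p) e →
                    φ (toggle (toggle S a) b) r ≡ toggle (φ (toggle S a) q) d → e ≡ d → b ≡ a
  no-backtracking {S} {a} {b} {e} p q r Ea Eab refl = toggle-injective (toggle S a) (begin
    toggle (toggle S a) b  ≡⟨ φ-injective r p (begin
      φ (toggle (toggle S a) b) r  ≡⟨ Eab ⟩
      toggle (φ (toggle S a) q) e  ≡⟨ cong (λ T → toggle T e) Ea ⟩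
      toggle (toggle (φ S p) e) e  ≡⟨ toggle-involutive (φ S p) e ⟩
      φ S p                        ∎) ⟩
    S                      ≡⟨ toggle-involutive S a ⟨
    toggle (toggle S a) a  ∎)
    where open ≡-Reasoning

  parallel-edges : ∀ {S a b ℓ} p q → b ≢ a → b ∉ S →
    (∀ p′ q′ → φ (toggle (toggle S b) a) q′ ≡ toggle (φ (toggle S b) p′) ℓ) →
    φ (toggle S a) q ≡ toggle (φ S p) ℓ
  parallel-edges {S} {a} {b} {ℓ} p q b≢a b∉S parallel =
    subst (λ e → φ (toggle S a) q ≡ toggle x e) (toggle-square x e≢c e≢d square) Ee
    where
    x = φ S p
    pb : P (toggle S b) ≡ true
    pb = upClosed (⊆-toggle b∉S) p
    qab : P (toggle (toggle S a) b) ≡ true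
    qab = upClosed (⊆-toggle (∉-toggle b≢a b∉S)) q
    qba : P (toggle (toggle S b) a) ≡ true
    qba = subst (λ T → P T ≡ true) (toggle-comm S (b≢a ∘ sym)) qab
    e = proj₁ (toggle-label S p a q)
    Ee = proj₂ (toggle-label S p a q)
    c = proj₁ (toggle-label S p b pb)
    Ec = proj₂ (toggle-label S p b pb)
    d = proj₁ (toggle-label (toggle S a) q b qab)
    Ed = proj₂ (toggle-label (toggle S a) q b qab)
    e≢c : e ≢ c
    e≢c = b≢a ∘ sym ∘ distinct-labels p q pb Ee Ec
    e≢d : e ≢ d
    e≢d = b≢a ∘ no-backtracking p q qab Ee Ed
    open ≡-Reasoning
    square : toggle (toggle x e) d ≡ toggle (toggle x c) ℓ
    square = begin
      toggle (toggle x e) d          ≡⟨ cong (λ T → toggle T d) Ee ⟨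
      toggle (φ (toggle S a) q) d    ≡⟨ Ed ⟨
      φ (toggle (toggle S a) b) qab  ≡⟨ φ-cong qab qba (toggle-comm S (b≢a ∘ sym)) ⟩
      φ (toggle (toggle S b) a) qba  ≡⟨ parallel pb qba ⟩
      toggle (φ (toggle S b) pb) ℓ   ≡⟨ cong (λ T → toggle T ℓ) Ec ⟩
      toggle (toggle x c) ℓ          ∎

  φ-toggle-near-⊤ : ∀ {S a} p q → (∀ b → b ≢ a → b ∈ S) → φ (toggle S a) q ≡ toggle (φ S p) (π a)
  φ-toggle-near-⊤ {S} {a} p q ∈S-except with near-⊤ ∈S-except
  ... | inj₁ S≡⊤ = begin
    φ (toggle S a) q        ≡⟨ φ-cong q (coatom∈ a) (cong (λ T → toggle T a) S≡⊤) ⟩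
    φ (toggle ⊤ a) _        ≡⟨ φ-coatom a ⟩
    toggle z (π a)          ≡⟨ cong (λ T → toggle T (π a)) (φ-cong ⊤∈ p (sym S≡⊤)) ⟩
    toggle (φ S p) (π a)    ∎
    where open ≡-Reasoning
  ... | inj₂ S⊕a≡⊤ = begin
    φ (toggle S a) q                 ≡⟨ φ-cong q ⊤∈ S⊕a≡⊤ ⟩
    z                                ≡⟨ toggle-involutive z (π a) ⟨
    toggle (toggle z (π a)) (π a)    ≡⟨ cong (λ T → toggle T (π a)) (φ-coatom a) ⟨
    toggle (φ (toggle ⊤ a) _) (π a)  ≡⟨ cong (λ T → toggle T (π a)) (φ-cong (coatom∈ a) p ⊤⊕a≡S) ⟩
    toggle (φ S p) (π a)             ∎
    where
    open ≡-Reasoning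
    ⊤⊕a≡S : toggle ⊤ a ≡ S
    ⊤⊕a≡S = trans (cong (λ T → toggle T a) (sym S⊕a≡⊤)) (toggle-involutive S a)

  φ-toggle : ∀ S p a q → φ (toggle S a) q ≡ toggle (φ S p) (π a)
  φ-toggle S = go S (<-wellFounded ∣ ∁ S ∣)
    where
    go : ∀ S → Acc _<_ ∣ ∁ S ∣ → ∀ p a q → φ (toggle S a) q ≡ toggle (φ S p) (π a)
    go S (acc rec) p a q with any? (λ b → ¬? (b ≟ a) ×-dec ¬? (b ∈? S))
    ... | yes (b , b≢a , b∉S) =
      parallel-edges p q b≢a b∉S (λ p′ → go (toggle S b) (rec (∣∁toggle∣<∣∁∣ b∉S)) p′ a)
    ... | no none = φ-toggle-near-⊤ p q
      (λ b b≢a → decidable-stable (b ∈? S) (λ b∉S → none (b , b≢a , b∉S)))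

  π-injective : ∀ {a b} → π a ≡ π b → a ≡ b
  π-injective {a} {b} πa≡πb = toggle-injective ⊤ (φ-injective (coatom∈ a) (coatom∈ b) (begin
    φ (toggle ⊤ a) _   ≡⟨ φ-coatom a ⟩
    toggle z (π a)     ≡⟨ cong (toggle z) πa≡πb ⟩
    toggle z (π b)     ≡⟨ φ-coatom b ⟨
    φ (toggle ⊤ b) _   ∎))
    where open ≡-Reasoning

  φ-untoggle : ∀ {S b} p (p₁ : P (toggle S b) ≡ true) → φ S p ≡ toggle (φ (toggle S b) p₁) (π b)
  φ-untoggle {S} {b} p p₁ = trans (φ-cong p q S≡S⊕b⊕b) (φ-toggle (toggle S b) p₁ b q)
    where
    S≡S⊕b⊕b = sym (toggle-involutive S b)
    q = subst (λ T → P T ≡ true) S≡S⊕b⊕b p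

  lookup-φ-untoggle : ∀ {S b} p (p₁ : P (toggle S b) ≡ true) c →
    lookup (φ (toggle S b) p₁) (π c) ≡ not (lookup (toggle S b) c) xor lookup z (π c) →
    lookup (φ S p) (π c) ≡ not (lookup S c) xor lookup z (π c)
  lookup-φ-untoggle {S} {b} p p₁ c hyp with c ≟ b
  ... | yes refl = begin
    lookup (φ S p) (π c)                              ≡⟨ cong (λ T → lookup T (π c)) (φ-untoggle p p₁) ⟩
    lookup (toggle (φ S₁ p₁) (π c)) (π c)             ≡⟨ lookup-toggle-≡ (φ S₁ p₁) (π c) ⟩
    not (lookup (φ S₁ p₁) (π c))                      ≡⟨ cong not hyp ⟩
    not (not (lookup S₁ c) xor w)                     ≡⟨ not-distribˡ-xor (not (lookup S₁ c)) w ⟩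
    not (not (lookup S₁ c)) xor w                     ≡⟨ cong (λ s → not (not s) xor w) (lookup-toggle-≡ S c) ⟩
    not (not (not (lookup S c))) xor w                ≡⟨ cong (_xor w) (not-involutive (not (lookup S c))) ⟩
    not (lookup S c) xor w                            ∎
    where
    open ≡-Reasoning
    S₁ = toggle S b
    w = lookup z (π c)
  ... | no c≢b = begin
    lookup (φ S p) (π c)                  ≡⟨ cong (λ T → lookup T (π c)) (φ-untoggle p p₁) ⟩
    lookup (toggle (φ S₁ p₁) (π b)) (π c) ≡⟨ lookup-toggle-≢ (φ S₁ p₁) (c≢b ∘ π-injective) ⟩
    lookup (φ S₁ p₁) (π c)                ≡⟨ hyp ⟩
    not (lookup S₁ c) xor lookup z (π c)  ≡⟨ cong (λ s → not s xor lookup z (π c)) (lookup-toggle-≢ S c≢b) ⟩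
    not (lookup S c) xor lookup z (π c)   ∎
    where
    open ≡-Reasoning
    S₁ = toggle S b

  lookup-φ : ∀ S p c → lookup (φ S p) (π c) ≡ not (lookup S c) xor lookup z (π c)
  lookup-φ S = go S (<-wellFounded ∣ ∁ S ∣)
    where
    go : ∀ S → Acc _<_ ∣ ∁ S ∣ → ∀ p c → lookup (φ S p) (π c) ≡ not (lookup S c) xor lookup z (π c)
    go S (acc rec) p c with ⊤-or-∉ S
    ... | inj₁ refl = begin
      lookup (φ ⊤ p) (π c)                ≡⟨ cong (λ T → lookup T (π c)) (φ-cong p ⊤∈ refl) ⟩
      not true xor lookup z (π c)         ≡⟨ cong (λ s → not s xor lookup z (π c)) ([]=⇒lookup (∈⊤ {x = c})) ⟨
      not (lookup ⊤ c) xor lookup z (π c) ∎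
      where open ≡-Reasoning
    ... | inj₂ (b , b∉S) = lookup-φ-untoggle p p₁ c (go (toggle S b) (rec (∣∁toggle∣<∣∁∣ b∉S)) p₁ c)
      where p₁ = upClosed (⊆-toggle b∉S) p

  preimage-∈ : (τ : Fin n′ → Fin n) → (∀ j → π (τ j) ≡ j) →
               ∀ {S} → P S ≡ true → P′ (preimage τ S) ≡ true
  preimage-∈ τ πτ {S} p = upClosed′ φT⊆τ*S (φ∈ T pT)
    where
    -- By lookup-φ, π c ∈ φ T exactly when c ∈ S and π c ∈ z.
    T = S ∪ tabulate (λ c → not (lookup z (π c)))
    pT = upClosed (p⊆p∪q _) p
    lookup-T : ∀ c → lookup T c ≡ lookup S c ∨ not (lookup z (π c))
    lookup-T c = trans (lookup-zipWith _∨_ c S _) (cong (lookup S c ∨_) (lookup∘tabulate _ c))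
    ∨-xor-true : ∀ s w → not (s ∨ not w) xor w ≡ true → s ≡ true
    ∨-xor-true true  _     _ = refl
    ∨-xor-true false true  ()
    ∨-xor-true false false ()
    φT⊆τ*S : φ T pT ⊆ preimage τ S
    φT⊆τ*S {j} j∈φT = lookup⇒[]= j _ (trans (lookup-preimage τ S j) (∨-xor-true s w (begin
      not (s ∨ not w) xor w                ≡⟨ cong (λ t → not t xor w) (lookup-T (τ j)) ⟨
      not (lookup T (τ j)) xor w           ≡⟨ lookup-φ T pT (τ j) ⟨
      lookup (φ T pT) (π (τ j))            ≡⟨ cong (lookup (φ T pT)) (πτ j) ⟩
      lookup (φ T pT) j                    ≡⟨ []=⇒lookup j∈φT ⟩
      true                                 ∎)))
      where
      open ≡-Reasoning
      s = lookup S (τ j)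
      w = lookup z (π (τ j))

-- preimage (σ ⟨$⟩ˡ_) S is the image of S under σ.
record Relabelling (P : Family n) (P′ : Family n′) : Set where
  field
    σ         : Permutation n n′
    preserves : ∀ {S} → P S ≡ true → P′ (preimage (σ ⟨$⟩ˡ_) S) ≡ true
    reflects  : ∀ {T} → P′ T ≡ true → P (preimage (σ ⟨$⟩ʳ_) T) ≡ true

relabelling-sym : ∀ {P : Family n} {P′ : Family n′} → Relabelling P P′ → Relabelling P′ P
relabelling-sym ρ = record { σ = Perm.flip σ ; preserves = reflects ; reflects = preserves }
  where open Relabelling ρ

flipGraphIso⇒relabelling : ∀ {P : Family n} {P′ : Family n′} →
  RobustFamily P → RobustFamily P′ → FlipGraphIso P P′ → Relabelling P P′
flipGraphIso⇒relabelling {P′ = P′} RP RP′ Φ = record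
  { σ         = permutation Fwd.π Bwd.π fwd∘bwd bwd∘fwd
  ; preserves = Fwd.preimage-∈ Bwd.π fwd∘bwd
  ; reflects  = Bwd.preimage-∈ Fwd.π bwd∘fwd
  }
  where
  module Fwd = EdgeLabelling RP (RobustFamily.upClosed RP′) Φ
  module Bwd = EdgeLabelling RP′ (RobustFamily.upClosed RP) (flipGraphIso-sym Φ)
  open ≡-Reasoning

  bwd-φ∘fwd-φ : ∀ S p q → Bwd.φ (Fwd.φ S p) q ≡ S
  bwd-φ∘fwd-φ S p q = trans (Bwd.φ-cong q (Fwd.φ∈ S p) refl)
                            (cong proj₁ (Inverse.strictlyInverseʳ (FlipGraphIso.bij Φ) (S , p)))

  bwd∘fwd : ∀ a → Bwd.π (Fwd.π a) ≡ a
  bwd∘fwd a = sym (toggle-injective ⊤ (begin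
    toggle ⊤ a                                ≡⟨ bwd-φ∘fwd-φ (toggle ⊤ a) _ q ⟨
    Bwd.φ (Fwd.φ (toggle ⊤ a) _) q            ≡⟨ Bwd.φ-cong q q′ (Fwd.φ-coatom a) ⟩
    Bwd.φ (toggle Fwd.z (Fwd.π a)) q′         ≡⟨ Bwd.φ-toggle Fwd.z (Fwd.φ∈ ⊤ _) (Fwd.π a) q′ ⟩
    toggle (Bwd.φ Fwd.z _) (Bwd.π (Fwd.π a))  ≡⟨ cong (λ T → toggle T (Bwd.π (Fwd.π a))) (bwd-φ∘fwd-φ ⊤ _ _) ⟩
    toggle ⊤ (Bwd.π (Fwd.π a))                ∎))
    where
    q = Fwd.φ∈ (toggle ⊤ a) (RobustFamily.coatom∈ RP a)
    q′ = subst (λ T → P′ T ≡ true) (Fwd.φ-coatom a) q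

  fwd∘bwd : ∀ a → Fwd.π (Bwd.π a) ≡ a
  fwd∘bwd a = Bwd.π-injective (bwd∘fwd (Bwd.π a))

module _ {X : VertexSetProperty} {G G′ : Graph} (ρ : Relabelling (X G) (X G′)) where
  open Relabelling ρ

  xNumber-≤ : ∀ {k k′} → IsXNumber X G k → IsXNumber X G′ k′ → k′ ≤ k
  xNumber-≤ ((S , S∈ , ∣S∣≡k) , _) (_ , k′-min) =
    ≤-trans (k′-min (preimage (σ ⟨$⟩ˡ_) S) (preserves S∈))
            (≤-reflexive (trans (∣preimage∣ (Perm.flip σ) S) ∣S∣≡k))

  minimal-preimage : ∀ {S} → MinimalXSet X G S → MinimalXSet X G′ (preimage (σ ⟨$⟩ˡ_) S)
  minimal-preimage {S} (S∈ , S-minimal) = preserves S∈ , λ T T⊆σS T∈ → begin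
    T                                          ≡⟨ σσ⁻¹ T ⟨
    preimage (σ ⟨$⟩ˡ_) (preimage (σ ⟨$⟩ʳ_) T)  ≡⟨ cong (preimage (σ ⟨$⟩ˡ_)) (S-minimal _ (σ⁻¹T⊆S T⊆σS) (reflects T∈)) ⟩
    preimage (σ ⟨$⟩ˡ_) S                       ∎
    where
    open ≡-Reasoning
    σσ⁻¹ : ∀ T → preimage (σ ⟨$⟩ˡ_) (preimage (σ ⟨$⟩ʳ_) T) ≡ T
    σσ⁻¹ = preimage-inverse (σ ⟨$⟩ˡ_) (σ ⟨$⟩ʳ_) (λ _ → Perm.inverseʳ σ)
    σ⁻¹σ : ∀ S → preimage (σ ⟨$⟩ʳ_) (preimage (σ ⟨$⟩ˡ_) S) ≡ S
    σ⁻¹σ = preimage-inverse (σ ⟨$⟩ʳ_) (σ ⟨$⟩ˡ_) (λ _ → Perm.inverseˡ σ)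
    σ⁻¹T⊆S : ∀ {T} → T ⊆ preimage (σ ⟨$⟩ˡ_) S → preimage (σ ⟨$⟩ʳ_) T ⊆ S
    σ⁻¹T⊆S {T} T⊆σS = subst (preimage (σ ⟨$⟩ʳ_) T ⊆_) (σ⁻¹σ S) (preimage-mono (σ ⟨$⟩ʳ_) T⊆σS)

  upperXNumber-≤ : ∀ {k k′} → IsUpperXNumber X G k → IsUpperXNumber X G′ k′ → k ≤ k′
  upperXNumber-≤ ((S , S-minimal , ∣S∣≡k) , _) (_ , k′-max) =
    ≤-trans (≤-reflexive (trans (sym ∣S∣≡k) (sym (∣preimage∣ (Perm.flip σ) S))))
            (k′-max (preimage (σ ⟨$⟩ˡ_) S) (minimal-preimage {S} S-minimal))

relabelling⇒≡xNumber : ∀ {X G G′ k k′} → Relabelling (X G) (X G′) →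
                        IsXNumber X G k → IsXNumber X G′ k′ → k ≡ k′
relabelling⇒≡xNumber {X} {G} {G′} ρ h h′ =
  ≤-antisym (xNumber-≤ {X} {G′} {G} (relabelling-sym ρ) h′ h) (xNumber-≤ {X} {G} {G′} ρ h h′)

relabelling⇒≡upperXNumber : ∀ {X G G′ k k′} → Relabelling (X G) (X G′) →
                             IsUpperXNumber X G k → IsUpperXNumber X G′ k′ → k ≡ k′
relabelling⇒≡upperXNumber {X} {G} {G′} ρ h h′ =
  ≤-antisym (upperXNumber-≤ {X} {G} {G′} ρ h h′) (upperXNumber-≤ {X} {G′} {G} (relabelling-sym ρ) h′ h)

-- Components and the X-sets of a robust parameter

reach-trans : ∀ {G u w v} → Reach G u w → Reach G w v → Reach G u v
reach-trans here           w⇝v = w⇝v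
reach-trans (step u~x x⇝w) w⇝v = step u~x (reach-trans x⇝w w⇝v)

reach-sym : ∀ {G u v} → Reach G u v → Reach G v u
reach-sym         here                       = here
reach-sym {G} {u} (step {w = w} u~w w⇝v) = reach-trans (reach-sym w⇝v) (step (trans (Graph.sym G w u) u~w) here)

EnumeratesComponent : (G : Graph) → V G → ∀ {k} → (Fin (suc k) → V G) → Set
EnumeratesComponent G v e = ∀ u → (Reach G v u → ∃ λ i → e i ≡ u) × (∃ (λ i → e i ≡ u) → Reach G v u)

induced-connected : ∀ {G v₀ k} {e : Fin (suc k) → V G} → Injective _≡_ _≡_ e →
                    EnumeratesComponent G v₀ e → Connected (induced G e)
induced-connected {G} {v₀} {e = e} e-inj comp i j =
  lift (reach-trans (reach-sym (from-root i)) (from-root j)) refl refl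
  where
  from-root : ∀ i → Reach G v₀ (e i)
  from-root i = proj₂ (comp (e i)) (i , refl)
  lift : ∀ {x y i j} → Reach G x y → e i ≡ x → e j ≡ y → Reach (induced G e) i j
  lift here ei≡x ej≡x = subst (Reach (induced G e) _) (e-inj (trans ei≡x (sym ej≡x))) here
  lift {i = i} (step {w = w} ei~w w⇝y) refl ej≡y = step ei~ei′ (lift w⇝y (proj₂ w∈e) ej≡y)
    where
    w∈e = proj₁ (comp w) (reach-trans (from-root i) (step ei~w here))
    ei~ei′ : adj G (e i) (e (proj₁ w∈e)) ≡ true
    ei~ei′ = subst (λ u → adj G (e i) u ≡ true) (sym (proj₂ w∈e)) ei~w

¬singleton-component : ∀ {G v₀} → NoIsolated G → (e : Fin 1 → V G) → ¬ EnumeratesComponent G v₀ e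
¬singleton-component {G} noIsolated e comp with noIsolated (e zero)
... | u , v~u with proj₁ (comp u) (reach-trans (proj₂ (comp (e zero)) (zero , refl)) (step v~u here))
... | zero , refl with trans (sym v~u) (irref G (e zero))
... | ()

singleton≅K₁ : ∀ G (e : Fin 1 → V G) → GraphIso (induced G e) K₁
singleton≅K₁ G e = record { bij = ↔-id (Fin 1) ; preserve = λ { zero zero → sym (irref G (e zero)) } }

module _ {X : VertexSetProperty} (R : RobustParameter X) where
  open RobustParameter R

  ⊤-isXSet : ∀ G → IsXSet X G ⊤
  ⊤-isXSet G = superset G _ ⊤ (proj₂ (cohesive G)) ⊆⊤

  component-coatom : ∀ {G v₀ k} (e : Fin (suc k) → V G) → IsXNumber X K₁ 0 ⊎ NoIsolated G →
                     Injective _≡_ _≡_ e → EnumeratesComponent G v₀ e →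
                     ∀ i → IsXSet X (induced G e) (toggle ⊤ i)
  component-coatom {k = suc _} e _ e-inj comp i =
    n-1-set _ (induced-connected e-inj comp) (s≤s z≤n) (toggle ⊤ i) (∣toggle⊤∣ i)
  component-coatom {G} {k = zero} e (inj₁ ((S , S∈ , ∣S∣≡0) , _)) _ _ zero =
    trans (sym (iso-invariant (induced G e) K₁ (singleton≅K₁ G e) ⊥)) (subst (IsXSet X K₁) (∣p∣≡0⇒p≡⊥ ∣S∣≡0) S∈)
  component-coatom {k = zero} e (inj₂ noIsolated) _ comp zero = ⊥-elim (¬singleton-component noIsolated e comp)

  coatom-isXSet : ∀ G → IsXNumber X K₁ 0 ⊎ NoIsolated G → ∀ v → IsXSet X G (toggle ⊤ v)
  coatom-isXSet G hyp v = proj₂ (component G (toggle ⊤ v)) on-component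
    where
    on-component : ∀ v₀ k (e : Fin (suc k) → V G) → Injective _≡_ _≡_ e → EnumeratesComponent G v₀ e →
                   IsXSet X (induced G e) (preimage e (toggle ⊤ v))
    on-component v₀ k e e-inj comp with any? (λ i → e i ≟ v)
    ... | yes (i , refl) = subst (IsXSet X (induced G e))
                             (sym (trans (preimage-toggle e-inj ⊤ i) (cong (λ T → toggle T i) (preimage-⊤ e))))
                             (component-coatom e hyp e-inj comp i)
    ... | no v∉e = subst (IsXSet X (induced G e))
                     (sym (trans (preimage-toggle-∉ (λ i ei≡v → v∉e (i , ei≡v)) ⊤) (preimage-⊤ e)))
                     (⊤-isXSet (induced G e))

  robustFamily : ∀ G → IsXNumber X K₁ 0 ⊎ NoIsolated G → RobustFamily (X G)
  robustFamily G hyp = record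
    { upClosed = λ {S} {T} S⊆T S∈ → superset G S T S∈ S⊆T
    ; ⊤∈       = ⊤-isXSet G
    ; coatom∈  = coatom-isXSet G hyp
    }

tarIso⇒flipGraphIso : ∀ {X G G′} → TARIso X G G′ → FlipGraphIso (X G) (X G′)
tarIso⇒flipGraphIso Φ = record
  { bij       = bij
  ; adjacent⁺ = λ a b → proj₁ (preserve a b)
  ; adjacent⁻ = λ a b → proj₂ (preserve a b)
  }
  where open TARIso Φ

corollary2p22 : (X : VertexSetProperty) → RobustParameter X →
    (G G′ : Graph) → TARIso X G G′ →
    (IsXNumber X K₁ 0 ⊎ (NoIsolated G × NoIsolated G′)) →
    (N G ≡ N G′)
    × (∀ k k′ → IsXNumber X G k → IsXNumber X G′ k′ → k ≡ k′)
    × (∀ k k′ → IsUpperXNumber X G k → IsUpperXNumber X G′ k′ → k ≡ k′)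
corollary2p22 X R G G′ Φ hyp =
    ↔⇒≡ (Relabelling.σ ρ)
  , (λ _ _ → relabelling⇒≡xNumber {X} {G} {G′} ρ)
  , (λ _ _ → relabelling⇒≡upperXNumber {X} {G} {G′} ρ)
  where
  ρ : Relabelling (X G) (X G′)
  ρ = flipGraphIso⇒relabelling (robustFamily R G (map₂ proj₁ hyp)) (robustFamily R G′ (map₂ proj₂ hyp))
                               (tarIso⇒flipGraphIso Φ)
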